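{- Let $m\ge 2$ and $j\ge 1$ be integers, let $i=j+m-1$, let $u\in\mathbb{Z}$, and let $d_1=2^{i-1}-2^{j-1}+u(2^m+1)$. Assume $\gcd(d_1,2^{2m}-1)=1$ and $\gcd(2^i-2^j,2^m+1)=1$. Let $U=\{x\in\mathbb{F}_{2^{2m}}: x^{2^m+1}=1\}$ and define $g:U\to U$ by $g(x)=x^{d_1}\bigl(1+x^{ -2^{j-1}}+x^{2^{i-1}}\bigr)^{2^m-1}$. Let $r_1,r_2$ be integers with $r_1\cdot 2^{m-1}\equiv 1 \pmod{2^m+1}$ and $r_2\cdot 2^{j-1}\equiv 1\pmod{2^m+1}$. Then the compositional inverse of $g$ on $U$ is $g^{ -1}(x)=x^{r_1r_2}$.
   Context: $U$ is the cyclic subgroup of order $2^m+1$ of the multiplicative group of $\mathbb{F}_{2^{2m}}$; negative integer powers of elements of $U$ are the usual group inverses. The hypotheses are those under which $x^{d_1}+x^{d_2}+x^{d_3}$, with $d_2=2^{i-1}+2^{j-1}+(u-2^{j-1})(2^{m}+1)$ and $d_3=-(2^{i-1}+2^{j-1})+(u+2^{i-1})(2^{m}+1)$, is a permutation trinomial of $\mathbb{F}_{2^{2m}}$ of the form $x^{d_1}(1+(x^{2^m-1})^{ -2^{j-1}}+(x^{2^m-1})^{2^{i-1}})$, and $g$ is its associated map on $U$. -}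

module Defs where

open import Level using (Level; _⊔_) renaming (suc to lsuc)
open import Algebra.Bundles using (CommutativeRing)
open import Data.Nat using (ℕ; zero; suc; _∸_; _^_) renaming (_+_ to _+ℕ_; _*_ to _*ℕ_)
open import Data.Integer using (ℤ; +_; -[1+_]) renaming (-_ to -ℤ_; _+_ to _+ℤ_; _-_ to _-ℤ_; _*_ to _*ℤ_)
open import Data.Fin using (Fin)
open import Relation.Nullary using (¬_)
open import Relation.Binary.PropositionalEquality using (_≡_)

-- A finite field with exactly q elements (up to the setoid equality ≈).
-- Every finite field of order q = 2^(2m) is isomorphic to F_{2^{2m}}.
record FiniteField (c ℓ : Level) (q : ℕ) : Set (lsuc (c ⊔ ℓ)) where
  field
    commutativeRing : CommutativeRing c ℓ
  open CommutativeRing commutativeRing public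
  field
    _⁻¹        : Carrier → Carrier
    1≉0        : ¬ (1# ≈ 0#)
    inverseʳ   : ∀ x → ¬ (x ≈ 0#) → (x * (x ⁻¹)) ≈ 1#
    enum       : Fin q → Carrier
    index      : Carrier → Fin q
    index-cong : ∀ {x y} → x ≈ y → index x ≡ index y
    enum-index : ∀ x → enum (index x) ≈ x
    index-enum : ∀ k → index (enum k) ≡ k

iExp : ℕ → ℕ → ℕ
iExp m j = j +ℕ m ∸ 1

d₁ : ℕ → ℕ → ℤ → ℤ
d₁ m j u = ((+ (2 ^ (iExp m j ∸ 1))) -ℤ (+ (2 ^ (j ∸ 1)))) +ℤ (u *ℤ (+ (2 ^ m +ℕ 1)))

module FF {c ℓ : Level} {q : ℕ} (F : FiniteField c ℓ q) where
  open FiniteField F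

  _^ℕ_ : Carrier → ℕ → Carrier
  x ^ℕ zero  = 1#
  x ^ℕ suc n = x * (x ^ℕ n)

  _^ℤ_ : Carrier → ℤ → Carrier
  x ^ℤ (+ n)     = x ^ℕ n
  x ^ℤ -[1+ n ]  = (x ⁻¹) ^ℕ suc n

  InU : ℕ → Carrier → Set ℓ
  InU m x = (x ^ℕ (2 ^ m +ℕ 1)) ≈ 1#

  g : ℕ → ℕ → ℤ → Carrier → Carrier
  g m j u x = (x ^ℤ d₁ m j u)
            * (((1# + (x ^ℤ (-ℤ (+ (2 ^ (j ∸ 1)))))) + (x ^ℤ (+ (2 ^ (iExp m j ∸ 1))))) ^ℕ (2 ^ m ∸ 1))

  h : ℤ → ℤ → Carrier → Carrier
  h r₁ r₂ x = x ^ℤ (r₁ *ℤ r₂)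

{-# OPTIONS --safe #-}
module Submission where

-- On U only exponents modulo N = 2^m + 1 matter. With b = 2^{i-1} = 2^{j-1} 2^{m-1} one has
-- -2^{j-1} ≡ 2b and d₁ ≡ 3b, so g(y) = z³ D^{2^m - 1} for z = y^b and D = 1 + z² + z.
-- A field with 2^{2m} elements has characteristic 2, so the Frobenius map gives z² D^{2^m} = D.
-- D ≠ 0, since otherwise z³ = 1 while z^N = 1, and 3 ∤ N because gcd(2^i - 2^j, N) = 1;
-- hence z² D^{2^m - 1} = 1 and g(y) = y^b. Finally r₁ r₂ b ≡ 1 (mod N), so x ↦ x^{r₁ r₂} inverts g on U.

open import Defs
open import Level using (Level)
open import Data.Nat using (ℕ; _≤_; _∸_; _^_) renaming (_+_ to _+ℕ_; _*_ to _*ℕ_)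
open import Data.Integer using (ℤ; +_; 1ℤ) renaming (_-_ to _-ℤ_; _*_ to _*ℤ_)
open import Data.Integer.GCD using (gcd)
open import Data.Integer.Divisibility using (_∣_)
open import Data.Product using (_×_)
open import Relation.Binary.PropositionalEquality using (_≡_)

open import Data.Nat using (zero; suc; s≤s; _%_; _/_)
import Data.Nat.Properties as ℕ
open import Data.Nat.DivMod using (m≡m%n+[m/n]*n; m%n<n)
open import Data.Nat.Divisibility using (∣1⇒≡1; ∣m+n∣m⇒∣n; m∣m*n) renaming (_∣_ to _∣ℕ_; divides to dividesℕ)
open import Data.Integer using (-[1+_]; 0ℤ) renaming (_+_ to _+ℤ_; -_ to -ℤ_)
open import Data.Integer.Properties using (pos-+; pos-*; +-injective; neg-distribˡ-*)
open import Data.Integer.Divisibility.Signed using (divides; ∣ᵤ⇒∣; ∣⇒∣ᵤ; ∣-refl; ∣m∣n⇒∣m+n; ∣m∣n⇒∣m-n; ∣m⇒∣m*n; ∣n⇒∣m*n)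
  renaming (_∣_ to _∣ₛ_)
open import Data.Integer.GCD using (gcd-greatest)
open import Data.Integer.Tactic.RingSolver using (solve-∀)
open import Data.Bool using (if_then_else_)
open import Data.Fin using (Fin; zero; suc; _<_)
open import Data.Fin.Properties using (_≟_; _<?_; <-cmp; <-asym; <-irrefl)
open import Data.Fin.Permutation using (permutation)
open import Data.Product using (_,_)
open import Function using (_∘_)
open import Relation.Binary using (Decidable; tri<; tri≈; tri>)
import Relation.Binary.PropositionalEquality as ≡
open import Relation.Nullary using (Dec; yes; no; does; ¬_; contradiction)
open import Relation.Nullary.Decidable using (map′; decidable-stable)
open import Algebra.Properties.CommutativeMonoid.Sum ℕ.+-0-commutativeMonoid
  using (sum; sum-cong-≗; ∑-distrib-+; sum-permute; sum-replicate-zero)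

module InvolutionParity where

  open ≡ using (refl; sym; trans; cong; cong₂; subst; module ≡-Reasoning)

  indicator : ∀ {p} {P : Set p} → Dec P → ℕ
  indicator d = if does d then 1 else 0

  indicator-yes : ∀ {p} {P : Set p} (d : Dec P) → P → indicator d ≡ 1
  indicator-yes (yes _) _ = refl
  indicator-yes (no ¬p) p = contradiction p ¬p

  indicator-no : ∀ {p} {P : Set p} (d : Dec P) → ¬ P → indicator d ≡ 0
  indicator-no (yes p) ¬p = contradiction p ¬p
  indicator-no (no _) _ = refl

  sum-ones : ∀ n → sum {n} (λ _ → 1) ≡ n
  sum-ones zero = refl
  sum-ones (suc n) = cong suc (sum-ones n)

  sum-indicator-≟ : ∀ {n} (k₀ : Fin n) → sum (λ k → indicator (k ≟ k₀)) ≡ 1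
  sum-indicator-≟ {suc n} zero = cong suc (sum-replicate-zero n)
  sum-indicator-≟ {suc n} (suc k₀) = sum-indicator-≟ k₀

  module _ {n : ℕ} (σ : Fin n → Fin n) (σ-involutive : ∀ k → σ (σ k) ≡ k)
           (k₀ : Fin n) (σk₀≡k₀ : σ k₀ ≡ k₀) (fixed⇒≡k₀ : ∀ k → σ k ≡ k → k ≡ k₀) where

    private
      below : Fin n → ℕ
      below k = indicator (k <? σ k)

      ≡k₀⇒fixed : ∀ {k} → k ≡ k₀ → σ k ≡ k
      ≡k₀⇒fixed refl = σk₀≡k₀

      -- Each k is counted once: as the smaller or the larger end of a 2-cycle, or as k₀.
      orbit-count : ∀ k → below k +ℕ below (σ k) +ℕ indicator (k ≟ k₀) ≡ 1
      orbit-count k with <-cmp k (σ k)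
      ... | tri< k<σk _ _ = cong₂ _+ℕ_
            (cong₂ _+ℕ_ (indicator-yes (k <? σ k) k<σk)
               (indicator-no (σ k <? σ (σ k)) (<-asym k<σk ∘ subst (σ k <_) (σ-involutive k))))
            (indicator-no (k ≟ k₀) (λ k≡k₀ → <-irrefl (sym (≡k₀⇒fixed k≡k₀)) k<σk))
      ... | tri≈ _ k≡σk _ = cong₂ _+ℕ_
            (cong₂ _+ℕ_ (indicator-no (k <? σ k) (<-irrefl k≡σk))
               (indicator-no (σ k <? σ (σ k)) (<-irrefl (trans (sym k≡σk) (sym (σ-involutive k))))))
            (indicator-yes (k ≟ k₀) (fixed⇒≡k₀ k (sym k≡σk)))
      ... | tri> _ _ σk<k = cong₂ _+ℕ_
            (cong₂ _+ℕ_ (indicator-no (k <? σ k) (<-asym σk<k))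
               (indicator-yes (σ k <? σ (σ k)) (subst (σ k <_) (sym (σ-involutive k)) σk<k)))
            (indicator-no (k ≟ k₀) (λ k≡k₀ → <-irrefl (≡k₀⇒fixed k≡k₀) σk<k))

      n≡2s+1 : n ≡ 2 *ℕ sum below +ℕ 1
      n≡2s+1 = begin
        n
          ≡⟨ sum-ones n ⟨
        sum {n} (λ _ → 1)
          ≡⟨ sum-cong-≗ (sym ∘ orbit-count) ⟩
        sum (λ k → below k +ℕ below (σ k) +ℕ indicator (k ≟ k₀))
          ≡⟨ ∑-distrib-+ (λ k → below k +ℕ below (σ k)) (λ k → indicator (k ≟ k₀)) ⟩
        sum (λ k → below k +ℕ below (σ k)) +ℕ sum (λ k → indicator (k ≟ k₀))
          ≡⟨ cong₂ _+ℕ_ (∑-distrib-+ below (below ∘ σ)) (sum-indicator-≟ k₀) ⟩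
        sum below +ℕ sum (below ∘ σ) +ℕ 1
          ≡⟨ cong (λ s → sum below +ℕ s +ℕ 1) (sum-permute below (permutation σ σ σ-involutive σ-involutive)) ⟨
        sum below +ℕ sum below +ℕ 1
          ≡⟨ cong (λ s → sum below +ℕ s +ℕ 1) (ℕ.+-identityʳ (sum below)) ⟨
        2 *ℕ sum below +ℕ 1
          ∎
        where open ≡-Reasoning

    involution-unique-fixedPoint⇒¬2∣n : ¬ 2 ∣ℕ n
    involution-unique-fixedPoint⇒¬2∣n 2∣n with ∣1⇒≡1 (∣m+n∣m⇒∣n (subst (2 ∣ℕ_) n≡2s+1 2∣n) (m∣m*n (sum below)))
    ... | ()

open InvolutionParity using (involution-unique-fixedPoint⇒¬2∣n)

module IntegerIdentities where

  i≡j+[i-j] : ∀ i j → i ≡ j +ℤ (i -ℤ j)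
  i≡j+[i-j] = solve-∀

  j-i≡-[i-j] : ∀ i j → j -ℤ i ≡ -ℤ (i -ℤ j)
  j-i≡-[i-j] = solve-∀

  i-i≡0 : ∀ i → i -ℤ i ≡ 0ℤ *ℤ i
  i-i≡0 = solve-∀

  [i-j]+[j-k]≡i-k : ∀ i j k → (i -ℤ j) +ℤ (j -ℤ k) ≡ i -ℤ k
  [i-j]+[j-k]≡i-k = solve-∀

  mS+S≡S[m+1] : ∀ m s → m *ℤ s -ℤ -ℤ s ≡ s *ℤ (m +ℤ 1ℤ)
  mS+S≡S[m+1] = solve-∀

  ea-1≡[e-k]a+[ka-1] : ∀ e k a → e *ℤ a -ℤ 1ℤ ≡ (e -ℤ k) *ℤ a +ℤ (k *ℤ a -ℤ 1ℤ)
  ea-1≡[e-k]a+[ka-1] = solve-∀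

  -q-2qp≡-q[2p+1] : ∀ q p → -ℤ q -ℤ q *ℤ p *ℤ + 2 ≡ -ℤ q *ℤ (+ 2 *ℤ p +ℤ 1ℤ)
  -q-2qp≡-q[2p+1] = solve-∀

  d₁-3b≡[u-q][2p+1] : ∀ q p u → (q *ℤ p -ℤ q) +ℤ u *ℤ (+ 2 *ℤ p +ℤ 1ℤ) -ℤ q *ℤ p *ℤ + 3 ≡ (u -ℤ q) *ℤ (+ 2 *ℤ p +ℤ 1ℤ)
  d₁-3b≡[u-q][2p+1] = solve-∀

  2qp-2q≡q[2p+1]-3q : ∀ q p → q *ℤ (+ 2 *ℤ p) -ℤ + 2 *ℤ q ≡ q *ℤ (+ 2 *ℤ p +ℤ 1ℤ) -ℤ + 3 *ℤ q
  2qp-2q≡q[2p+1]-3q = solve-∀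

  rs[qp]-1≡[rp-1][sq]+[sq-1] : ∀ r s p q → (r *ℤ s) *ℤ (q *ℤ p) -ℤ 1ℤ ≡ (r *ℤ p -ℤ 1ℤ) *ℤ (s *ℤ q) +ℤ (s *ℤ q -ℤ 1ℤ)
  rs[qp]-1≡[rp-1][sq]+[sq-1] = solve-∀

  a-b≡tN⇒a≡b+tN : ∀ {a b t n} → + a -ℤ + b ≡ + t *ℤ + n → a ≡ b +ℕ t *ℕ n
  a-b≡tN⇒a≡b+tN {a} {b} {t} {n} a-b≡tN = +-injective (begin
    + a                    ≡⟨ i≡j+[i-j] (+ a) (+ b) ⟩
    + b +ℤ (+ a -ℤ + b)    ≡⟨ ≡.cong (+ b +ℤ_) a-b≡tN ⟩
    + b +ℤ + t *ℤ + n      ≡⟨ ≡.cong (+ b +ℤ_) (pos-* t n) ⟨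
    + b +ℤ + (t *ℕ n)      ≡⟨ pos-+ b (t *ℕ n) ⟨
    + (b +ℕ t *ℕ n)        ∎)
    where open ≡.≡-Reasoning

open IntegerIdentities

module Modulus (m : ℕ) where

  M N : ℕ
  M = 2 ^ m
  N = M +ℕ 1

  rep : ℤ → ℕ
  rep (+ n) = n
  rep -[1+ n ] = M *ℕ suc n

  rep-congruent : ∀ k → + N ∣ₛ + rep k -ℤ k
  rep-congruent (+ n) = divides 0ℤ (i-i≡0 (+ n))
  rep-congruent -[1+ n ] = divides (+ suc n) (begin
    + (M *ℕ suc n) -ℤ -[1+ n ]                ≡⟨ ≡.cong (_-ℤ -[1+ n ]) (pos-* M (suc n)) ⟩
    + M *ℤ + suc n -ℤ -ℤ (+ suc n)           ≡⟨ mS+S≡S[m+1] (+ M) (+ suc n) ⟩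
    + suc n *ℤ (+ M +ℤ + 1)                  ≡⟨ ≡.cong (+ suc n *ℤ_) (pos-+ M 1) ⟨
    + suc n *ℤ + N                           ∎)
    where open ≡.≡-Reasoning

  rep-*-congruent : ∀ {k b} → + N ∣ₛ k *ℤ + b -ℤ 1ℤ → + N ∣ₛ + (rep k *ℕ b) -ℤ 1ℤ
  rep-*-congruent {k} {b} N∣kb-1 = ≡.subst (+ N ∣ₛ_) eq
    (∣m∣n⇒∣m+n (∣m⇒∣m*n (+ b) (rep-congruent k)) N∣kb-1)
    where
    eq : (+ rep k -ℤ k) *ℤ + b +ℤ (k *ℤ + b -ℤ 1ℤ) ≡ + (rep k *ℕ b) -ℤ 1ℤ
    eq = ≡.sym (≡.trans (≡.cong (_-ℤ 1ℤ) (pos-* (rep k) b)) (ea-1≡[e-k]a+[ka-1] (+ rep k) k (+ b)))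

module Exponents (m′ j′ : ℕ) where

  open Modulus (suc m′)

  P Q b : ℕ
  P = 2 ^ m′
  Q = 2 ^ j′
  b = 2 ^ (iExp (suc m′) (suc j′) ∸ 1)

  +N≡2P+1 : + N ≡ + 2 *ℤ + P +ℤ 1ℤ
  +N≡2P+1 = ≡.trans (pos-+ (2 *ℕ P) 1) (≡.cong (_+ℤ 1ℤ) (pos-* 2 P))

  +b≡QP : + b ≡ + Q *ℤ + P
  +b≡QP = ≡.trans (≡.cong (λ e → + 2 ^ (e ∸ 1)) (ℕ.+-suc j′ m′)) (≡.trans (≡.cong +_ (ℕ.^-distribˡ-+-* 2 j′ m′)) (pos-* Q P))

  +b*k≡QP*k : ∀ k → + (b *ℕ k) ≡ + Q *ℤ + P *ℤ + k
  +b*k≡QP*k k = ≡.trans (pos-* b k) (≡.cong (_*ℤ + k) +b≡QP)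

  N∣-Q-2b : + N ∣ₛ -ℤ (+ Q) -ℤ + (b *ℕ 2)
  N∣-Q-2b = divides (-ℤ (+ Q)) (begin
    -ℤ (+ Q) -ℤ + (b *ℕ 2)                  ≡⟨ ≡.cong (λ e → -ℤ (+ Q) -ℤ e) (+b*k≡QP*k 2) ⟩
    -ℤ (+ Q) -ℤ + Q *ℤ + P *ℤ + 2           ≡⟨ -q-2qp≡-q[2p+1] (+ Q) (+ P) ⟩
    -ℤ (+ Q) *ℤ (+ 2 *ℤ + P +ℤ 1ℤ)          ≡⟨ ≡.cong (-ℤ (+ Q) *ℤ_) +N≡2P+1 ⟨
    -ℤ (+ Q) *ℤ + N                         ∎)
    where open ≡.≡-Reasoning

  N∣d₁-3b : ∀ u → + N ∣ₛ d₁ (suc m′) (suc j′) u -ℤ + (b *ℕ 3)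
  N∣d₁-3b u = divides (u -ℤ + Q) (begin
    (+ b -ℤ + Q) +ℤ u *ℤ + N -ℤ + (b *ℕ 3)                                   ≡⟨ ≡.cong₂ (λ e f → (e -ℤ + Q) +ℤ u *ℤ + N -ℤ f) +b≡QP (+b*k≡QP*k 3) ⟩
    (+ Q *ℤ + P -ℤ + Q) +ℤ u *ℤ + N -ℤ + Q *ℤ + P *ℤ + 3              ≡⟨ ≡.cong (λ n → (+ Q *ℤ + P -ℤ + Q) +ℤ u *ℤ n -ℤ + Q *ℤ + P *ℤ + 3) +N≡2P+1 ⟩
    (+ Q *ℤ + P -ℤ + Q) +ℤ u *ℤ (+ 2 *ℤ + P +ℤ 1ℤ) -ℤ + Q *ℤ + P *ℤ + 3 ≡⟨ d₁-3b≡[u-q][2p+1] (+ Q) (+ P) u ⟩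
    (u -ℤ + Q) *ℤ (+ 2 *ℤ + P +ℤ 1ℤ)                                         ≡⟨ ≡.cong ((u -ℤ + Q) *ℤ_) +N≡2P+1 ⟨
    (u -ℤ + Q) *ℤ + N                                                        ∎)
    where open ≡.≡-Reasoning

  2ⁱ-2ʲ : ℤ
  2ⁱ-2ʲ = + (2 ^ iExp (suc m′) (suc j′)) -ℤ + (2 ^ suc j′)

  3∣N⇒3∣2ⁱ-2ʲ : 3 ∣ℕ N → + 3 ∣ₛ 2ⁱ-2ʲ
  3∣N⇒3∣2ⁱ-2ʲ 3∣N = ≡.subst (+ 3 ∣ₛ_) (≡.sym 2ⁱ-2ʲ≡QN-3Q)
    (∣m∣n⇒∣m-n (∣n⇒∣m*n (+ Q) (≡.subst (+ 3 ∣ₛ_) +N≡2P+1 (∣ᵤ⇒∣ 3∣N))) (∣m⇒∣m*n (+ Q) ∣-refl))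
    where
    +2ⁱ≡Q*2P : + (2 ^ iExp (suc m′) (suc j′)) ≡ + Q *ℤ (+ 2 *ℤ + P)
    +2ⁱ≡Q*2P = ≡.trans (≡.cong +_ (ℕ.^-distribˡ-+-* 2 j′ (suc m′)))
      (≡.trans (pos-* Q (2 *ℕ P)) (≡.cong (+ Q *ℤ_) (pos-* 2 P)))
    2ⁱ-2ʲ≡QN-3Q : 2ⁱ-2ʲ ≡ + Q *ℤ (+ 2 *ℤ + P +ℤ 1ℤ) -ℤ + 3 *ℤ + Q
    2ⁱ-2ʲ≡QN-3Q = ≡.trans (≡.cong₂ _-ℤ_ +2ⁱ≡Q*2P (pos-* 2 Q)) (2qp-2q≡q[2p+1]-3q (+ Q) (+ P))

  ¬3∣N : gcd 2ⁱ-2ʲ (+ N) ≡ + 1 → ¬ 3 ∣ℕ N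
  ¬3∣N gcd≡1 3∣N with ∣1⇒≡1 (≡.subst (+ 3 ∣_) gcd≡1 (gcd-greatest {2ⁱ-2ʲ} {+ N} {+ 3} (∣⇒∣ᵤ (3∣N⇒3∣2ⁱ-2ʲ 3∣N)) 3∣N))
  ... | ()

  N∣r₁r₂b-1 : ∀ {r₁ r₂} → + N ∣ r₁ *ℤ + P -ℤ 1ℤ → + N ∣ r₂ *ℤ + Q -ℤ 1ℤ → + N ∣ₛ (r₁ *ℤ r₂) *ℤ + b -ℤ 1ℤ
  N∣r₁r₂b-1 {r₁} {r₂} N∣r₁P-1 N∣r₂Q-1 = ≡.subst (+ N ∣ₛ_) (≡.sym eq)
    (∣m∣n⇒∣m+n (∣m⇒∣m*n (r₂ *ℤ + Q) (∣ᵤ⇒∣ {+ N} {r₁ *ℤ + P -ℤ 1ℤ} N∣r₁P-1)) (∣ᵤ⇒∣ {+ N} {r₂ *ℤ + Q -ℤ 1ℤ} N∣r₂Q-1))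
    where
    eq : (r₁ *ℤ r₂) *ℤ + b -ℤ 1ℤ ≡ (r₁ *ℤ + P -ℤ 1ℤ) *ℤ (r₂ *ℤ + Q) +ℤ (r₂ *ℤ + Q -ℤ 1ℤ)
    eq = ≡.trans (≡.cong (λ e → (r₁ *ℤ r₂) *ℤ e -ℤ 1ℤ) +b≡QP)
      (rs[qp]-1≡[rp-1][sq]+[sq-1] r₁ r₂ (+ P) (+ Q))

module FieldProperties {c ℓ q} (F : FiniteField c ℓ q) where

  open FiniteField F
  open FF F
  open import Relation.Binary.Reasoning.Setoid setoid
  import Algebra.Properties.CommutativeSemiring.Exp commutativeSemiring as Exp
  open import Algebra.Solver.CommutativeMonoid +-commutativeMonoid using (solve; _⊕_; _⊜_)

  ^ℕ≡^ : ∀ x n → x ^ℕ n ≡ x Exp.^ n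
  ^ℕ≡^ x zero = ≡.refl
  ^ℕ≡^ x (suc n) = ≡.cong (x *_) (^ℕ≡^ x n)

  ^ℕ-congˡ : ∀ n {x y} → x ≈ y → x ^ℕ n ≈ y ^ℕ n
  ^ℕ-congˡ n {x} {y} rewrite ^ℕ≡^ x n | ^ℕ≡^ y n = Exp.^-congˡ n

  ^ℕ-congʳ : ∀ x {a b} → a ≡ b → x ^ℕ a ≈ x ^ℕ b
  ^ℕ-congʳ x ≡.refl = refl

  ^ℕ-homo-* : ∀ x a b → x ^ℕ (a +ℕ b) ≈ x ^ℕ a * x ^ℕ b
  ^ℕ-homo-* x a b rewrite ^ℕ≡^ x (a +ℕ b) | ^ℕ≡^ x a | ^ℕ≡^ x b = Exp.^-homo-* x a b

  ^ℕ-assocʳ : ∀ x a b → (x ^ℕ a) ^ℕ b ≈ x ^ℕ (a *ℕ b)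
  ^ℕ-assocʳ x a b rewrite ^ℕ≡^ x a | ^ℕ≡^ (x Exp.^ a) b | ^ℕ≡^ x (a *ℕ b) = Exp.^-assocʳ x a b

  1^ℕ≈1 : ∀ n → 1# ^ℕ n ≈ 1#
  1^ℕ≈1 zero = refl
  1^ℕ≈1 (suc n) = trans (*-identityˡ _) (1^ℕ≈1 n)

  x^ℕ2≈x*x : ∀ x → x ^ℕ 2 ≈ x * x
  x^ℕ2≈x*x x = *-congˡ (*-identityʳ x)

  index-injective : ∀ {x y} → index x ≡ index y → x ≈ y
  index-injective {x} {y} eq = trans (sym (enum-index x)) (trans (reflexive (≡.cong enum eq)) (enum-index y))

  infix 4 _≈?_
  _≈?_ : Decidable _≈_
  x ≈? y = map′ index-injective index-cong (index x ≟ index y)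

  *-cancelʳ : ∀ {x y z} → ¬ z ≈ 0# → x * z ≈ y * z → x ≈ y
  *-cancelʳ {x} {y} {z} z≉0 xz≈yz = begin
    x                ≈⟨ *-identityʳ x ⟨
    x * 1#           ≈⟨ *-congˡ (inverseʳ z z≉0) ⟨
    x * (z * z ⁻¹)   ≈⟨ *-assoc x z (z ⁻¹) ⟨
    (x * z) * z ⁻¹   ≈⟨ *-congʳ xz≈yz ⟩
    (y * z) * z ⁻¹   ≈⟨ *-assoc y z (z ⁻¹) ⟩
    y * (z * z ⁻¹)   ≈⟨ *-congˡ (inverseʳ z z≉0) ⟩
    y * 1#           ≈⟨ *-identityʳ y ⟩
    y                ∎

  x+x≈[1+1]*x : ∀ x → x + x ≈ (1# + 1#) * x
  x+x≈[1+1]*x x = sym (trans (distribʳ x 1# 1#) (+-cong (*-identityˡ x) (*-identityˡ x)))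

  -- x ↦ -x is an involution on the field whose only fixed point is 0 unless 1 + 1 ≈ 0.
  characteristic-two : 2 ∣ℕ q → 1# + 1# ≈ 0#
  characteristic-two 2∣q = decidable-stable (1# + 1# ≈? 0#) λ 2≉0 →
    involution-unique-fixedPoint⇒¬2∣n σ σ-involutive (index 0#) σ0≡0 (fixed⇒≡0 2≉0) 2∣q
    where
    σ : Fin q → Fin q
    σ k = index (- enum k)

    σ-involutive : ∀ k → σ (σ k) ≡ k
    σ-involutive k = ≡.trans (index-cong (trans (-‿cong (enum-index _)) (⁻¹-involutive _))) (index-enum k)
      where open import Algebra.Properties.Group +-group using (⁻¹-involutive)

    σ0≡0 : σ (index 0#) ≡ index 0#
    σ0≡0 = index-cong (trans (-‿cong (enum-index 0#)) -0#≈0#)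
      where open import Algebra.Properties.Ring ring using (-0#≈0#)

    fixed⇒≡0 : ¬ 1# + 1# ≈ 0# → ∀ k → σ k ≡ k → k ≡ index 0#
    fixed⇒≡0 2≉0 k σk≡k = ≡.trans (≡.sym (index-enum k)) (index-cong x≈0)
      where
      x = enum k
      -x≈x : - x ≈ x
      -x≈x = trans (sym (enum-index (- x))) (reflexive (≡.cong enum σk≡k))
      x≈0 : x ≈ 0#
      x≈0 = *-cancelʳ 2≉0 (begin
        x * (1# + 1#)  ≈⟨ *-comm x _ ⟩
        (1# + 1#) * x  ≈⟨ x+x≈[1+1]*x x ⟨
        x + x          ≈⟨ +-congˡ -x≈x ⟨
        x + - x        ≈⟨ -‿inverseʳ x ⟩
        0#             ≈⟨ zeroˡ _ ⟨
        0# * (1# + 1#) ∎)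

  ^ℕ-periodic : ∀ {z k} r t → z ^ℕ k ≈ 1# → z ^ℕ (r +ℕ t *ℕ k) ≈ z ^ℕ r
  ^ℕ-periodic {z} {k} r t zᵏ≈1 = begin
    z ^ℕ (r +ℕ t *ℕ k)          ≈⟨ ^ℕ-homo-* z r _ ⟩
    z ^ℕ r * z ^ℕ (t *ℕ k)      ≈⟨ *-congˡ (^ℕ-congʳ z (ℕ.*-comm t k)) ⟩
    z ^ℕ r * z ^ℕ (k *ℕ t)      ≈⟨ *-congˡ (^ℕ-assocʳ z k t) ⟨
    z ^ℕ r * (z ^ℕ k) ^ℕ t      ≈⟨ *-congˡ (trans (^ℕ-congˡ t zᵏ≈1) (1^ℕ≈1 t)) ⟩
    z ^ℕ r * 1#                 ≈⟨ *-identityʳ _ ⟩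
    z ^ℕ r                      ∎

  z³≈1⇒z≈1 : ∀ {z} n → ¬ 3 ∣ℕ n → z ^ℕ n ≈ 1# → z ^ℕ 3 ≈ 1# → z ≈ 1#
  z³≈1⇒z≈1 {z} n 3∤n zⁿ≈1 z³≈1 with n % 3 | m≡m%n+[m/n]*n n 3 | m%n<n n 3
  ... | 0 | n≡t*3 | _ = contradiction (dividesℕ (n / 3) n≡t*3) 3∤n
  ... | 1 | n≡1+t*3 | _ = begin
    z                          ≈⟨ *-identityʳ z ⟨
    z ^ℕ 1                     ≈⟨ ^ℕ-periodic 1 (n / 3) z³≈1 ⟨
    z ^ℕ (1 +ℕ (n / 3) *ℕ 3)   ≈⟨ ^ℕ-congʳ z n≡1+t*3 ⟨
    z ^ℕ n                     ≈⟨ zⁿ≈1 ⟩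
    1#                         ∎
  ... | 2 | n≡2+t*3 | _ = begin
    z                          ≈⟨ *-identityʳ z ⟨
    z * 1#                     ≈⟨ *-congˡ z²≈1 ⟨
    z * z ^ℕ 2                 ≈⟨ z³≈1 ⟩
    1#                         ∎
    where
    z²≈1 : z ^ℕ 2 ≈ 1#
    z²≈1 = trans (sym (^ℕ-periodic 2 (n / 3) z³≈1)) (trans (^ℕ-congʳ z (≡.sym n≡2+t*3)) zⁿ≈1)
  ... | suc (suc (suc _)) | _ | s≤s (s≤s (s≤s ()))

  module Characteristic2 (1+1≈0 : 1# + 1# ≈ 0#) where

    x+x≈0 : ∀ x → x + x ≈ 0#
    x+x≈0 x = trans (x+x≈[1+1]*x x) (trans (*-congʳ 1+1≈0) (zeroˡ x))

    x+y≈0⇒y≈x : ∀ {x y} → x + y ≈ 0# → y ≈ x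
    x+y≈0⇒y≈x {x} {y} x+y≈0 = begin
      y              ≈⟨ +-identityˡ y ⟨
      0# + y         ≈⟨ +-congʳ (x+x≈0 x) ⟨
      (x + x) + y    ≈⟨ +-assoc x x y ⟩
      x + (x + y)    ≈⟨ +-congˡ x+y≈0 ⟩
      x + 0#         ≈⟨ +-identityʳ x ⟩
      x              ∎

    square-+ : ∀ x y → (x + y) * (x + y) ≈ x * x + y * y
    square-+ x y = begin
      (x + y) * (x + y)                  ≈⟨ distribʳ (x + y) x y ⟩
      x * (x + y) + y * (x + y)          ≈⟨ +-cong (distribˡ x x y) (distribˡ y x y) ⟩
      (x * x + x * y) + (y * x + y * y)  ≈⟨ solve 4 (λ a b c d → (a ⊕ b) ⊕ (c ⊕ d) ⊜ (a ⊕ d) ⊕ (b ⊕ c)) refl (x * x) (x * y) (y * x) (y * y) ⟩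
      (x * x + y * y) + (x * y + y * x)  ≈⟨ +-congˡ (trans (+-congˡ (*-comm y x)) (x+x≈0 (x * y))) ⟩
      (x * x + y * y) + 0#               ≈⟨ +-identityʳ _ ⟩
      x * x + y * y                      ∎

    frobenius : ∀ k x y → (x + y) ^ℕ (2 ^ k) ≈ x ^ℕ (2 ^ k) + y ^ℕ (2 ^ k)
    frobenius zero x y = trans (*-identityʳ (x + y)) (sym (+-cong (*-identityʳ x) (*-identityʳ y)))
    frobenius (suc k) x y = begin
      (x + y) ^ℕ (2 *ℕ 2 ^ k)                    ≈⟨ ^ℕ-assocʳ (x + y) 2 (2 ^ k) ⟨
      ((x + y) ^ℕ 2) ^ℕ (2 ^ k)                  ≈⟨ ^ℕ-congˡ (2 ^ k) square ⟩
      (x ^ℕ 2 + y ^ℕ 2) ^ℕ (2 ^ k)               ≈⟨ frobenius k _ _ ⟩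
      (x ^ℕ 2) ^ℕ (2 ^ k) + (y ^ℕ 2) ^ℕ (2 ^ k)  ≈⟨ +-cong (^ℕ-assocʳ x 2 (2 ^ k)) (^ℕ-assocʳ y 2 (2 ^ k)) ⟩
      x ^ℕ (2 *ℕ 2 ^ k) + y ^ℕ (2 *ℕ 2 ^ k)      ∎
      where
      square : (x + y) ^ℕ 2 ≈ x ^ℕ 2 + y ^ℕ 2
      square = trans (x^ℕ2≈x*x (x + y)) (trans (square-+ x y) (sym (+-cong (x^ℕ2≈x*x x) (x^ℕ2≈x*x y))))

    [1+z]*[1+z²+z]≈1+z³ : ∀ z → (1# + z) * ((1# + z ^ℕ 2) + z) ≈ 1# + z ^ℕ 3
    [1+z]*[1+z²+z]≈1+z³ z = begin
      (1# + z) * D                                ≈⟨ distribʳ D 1# z ⟩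
      1# * D + z * D                              ≈⟨ +-cong (*-identityˡ D) z*D ⟩
      ((1# + z ^ℕ 2) + z) + ((z + z ^ℕ 3) + z ^ℕ 2)  ≈⟨ solve 4 (λ o a b c → ((o ⊕ a) ⊕ b) ⊕ ((b ⊕ c) ⊕ a) ⊜ (o ⊕ c) ⊕ ((b ⊕ b) ⊕ (a ⊕ a))) refl 1# (z ^ℕ 2) z (z ^ℕ 3) ⟩
      (1# + z ^ℕ 3) + ((z + z) + (z ^ℕ 2 + z ^ℕ 2))  ≈⟨ +-congˡ (trans (+-cong (x+x≈0 z) (x+x≈0 (z ^ℕ 2))) (+-identityʳ 0#)) ⟩
      (1# + z ^ℕ 3) + 0#                          ≈⟨ +-identityʳ _ ⟩
      1# + z ^ℕ 3                                 ∎
      where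
      D = (1# + z ^ℕ 2) + z
      z*D : z * D ≈ (z + z ^ℕ 3) + z ^ℕ 2
      z*D = trans (distribˡ z _ z) (+-cong (trans (distribˡ z 1# _) (+-congʳ (*-identityʳ z))) (sym (x^ℕ2≈x*x z)))

  module UnitCircle (m : ℕ) where

    open Modulus m

    InU-resp-≈ : ∀ {x y} → x ≈ y → InU m y → InU m x
    InU-resp-≈ x≈y yU = trans (^ℕ-congˡ N x≈y) yU

    InU-^ℕ : ∀ {x} n → InU m x → InU m (x ^ℕ n)
    InU-^ℕ {x} n xU = trans (^ℕ-assocʳ x n N) (^ℕ-periodic 0 n xU)

    x*x^M≈1 : ∀ {x} → InU m x → x * x ^ℕ M ≈ 1#
    x*x^M≈1 {x} xU = trans (^ℕ-congʳ x (ℕ.+-comm 1 M)) xU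

    InU⇒≉0 : ∀ {x} → InU m x → ¬ x ≈ 0#
    InU⇒≉0 {x} xU x≈0 = 1≉0 (begin
      1#             ≈⟨ x*x^M≈1 xU ⟨
      x * x ^ℕ M     ≈⟨ *-congʳ x≈0 ⟩
      0# * x ^ℕ M    ≈⟨ zeroˡ _ ⟩
      0#             ∎)

    ⁻¹≈^M : ∀ {x} → InU m x → x ⁻¹ ≈ x ^ℕ M
    ⁻¹≈^M {x} xU = *-cancelʳ (InU⇒≉0 xU)
      (trans (*-comm _ x) (trans (inverseʳ x (InU⇒≉0 xU)) (sym (trans (*-comm _ x) (x*x^M≈1 xU)))))

    ^ℕ-congruent : ∀ {x a b} → InU m x → + N ∣ₛ + a -ℤ + b → x ^ℕ a ≈ x ^ℕ b
    ^ℕ-congruent {x} {a} {b} xU (divides (+ t) a-b≡tN) =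
      trans (^ℕ-congʳ x (a-b≡tN⇒a≡b+tN {a} {b} {t} {N} a-b≡tN)) (^ℕ-periodic {k = N} b t xU)
    ^ℕ-congruent {x} {a} {b} xU (divides -[1+ t ] a-b≡-[1+t]N) =
      sym (trans (^ℕ-congʳ x (a-b≡tN⇒a≡b+tN {b} {a} {suc t} {N} b-a≡[1+t]N)) (^ℕ-periodic {k = N} a (suc t) xU))
      where
      b-a≡[1+t]N : + b -ℤ + a ≡ + suc t *ℤ + N
      b-a≡[1+t]N = ≡.trans (j-i≡-[i-j] (+ a) (+ b))
        (≡.trans (≡.cong -ℤ_ a-b≡-[1+t]N) (neg-distribˡ-* -[1+ t ] (+ N)))

    ^ℤ≈^ℕ-rep : ∀ {x} → InU m x → ∀ k → x ^ℤ k ≈ x ^ℕ rep k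
    ^ℤ≈^ℕ-rep xU (+ n) = refl
    ^ℤ≈^ℕ-rep {x} xU -[1+ n ] = trans (^ℕ-congˡ (suc n) (⁻¹≈^M xU)) (^ℕ-assocʳ x M (suc n))

    ^ℤ-congruent : ∀ {x} k n → InU m x → + N ∣ₛ k -ℤ + n → x ^ℤ k ≈ x ^ℕ n
    ^ℤ-congruent k n xU N∣k-n = trans (^ℤ≈^ℕ-rep xU k)
      (^ℕ-congruent {a = rep k} {n} xU (≡.subst (+ N ∣ₛ_) ([i-j]+[j-k]≡i-k (+ rep k) k (+ n)) (∣m∣n⇒∣m+n (rep-congruent k) N∣k-n)))

    ^ℕ-inverse : ∀ {x} a b → InU m x → + N ∣ₛ + (a *ℕ b) -ℤ 1ℤ → (x ^ℕ a) ^ℕ b ≈ x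
    ^ℕ-inverse {x} a b xU N∣ab-1 = trans (^ℕ-assocʳ x a b) (trans (^ℕ-congruent {a = a *ℕ b} {1} xU N∣ab-1) (*-identityʳ x))

    module _ (1+1≈0 : 1# + 1# ≈ 0#) (3∤N : ¬ 3 ∣ℕ N) {z : Carrier} (zU : InU m z) where

      open Characteristic2 1+1≈0

      private
        D : Carrier
        D = (1# + z ^ℕ 2) + z

      z²*z^M≈z : z ^ℕ 2 * z ^ℕ M ≈ z
      z²*z^M≈z = begin
        z ^ℕ 2 * z ^ℕ M    ≈⟨ ^ℕ-homo-* z 2 M ⟨
        z * (z * z ^ℕ M)   ≈⟨ *-congˡ (x*x^M≈1 zU) ⟩
        z * 1#             ≈⟨ *-identityʳ z ⟩
        z                  ∎

      z²*D^M≈D : z ^ℕ 2 * D ^ℕ M ≈ D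
      z²*D^M≈D = begin
        z ^ℕ 2 * D ^ℕ M                                           ≈⟨ *-congˡ D^M≈ ⟩
        z ^ℕ 2 * ((1# + (z ^ℕ 2) ^ℕ M) + z ^ℕ M)                  ≈⟨ trans (distribˡ _ _ _) (+-congʳ (distribˡ _ _ _)) ⟩
        (z ^ℕ 2 * 1# + z ^ℕ 2 * (z ^ℕ 2) ^ℕ M) + z ^ℕ 2 * z ^ℕ M  ≈⟨ +-cong (+-cong (*-identityʳ _) (x*x^M≈1 (InU-^ℕ 2 zU))) z²*z^M≈z ⟩
        (z ^ℕ 2 + 1#) + z                                         ≈⟨ +-congʳ (+-comm _ 1#) ⟩
        D                                                         ∎
        where
        D^M≈ : D ^ℕ M ≈ (1# + (z ^ℕ 2) ^ℕ M) + z ^ℕ M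
        D^M≈ = trans (frobenius m _ z) (+-congʳ (trans (frobenius m 1# _) (+-congʳ (1^ℕ≈1 M))))

      D≉0 : ¬ D ≈ 0#
      D≉0 D≈0 = 1≉0 (begin
        1#                      ≈⟨ +-identityˡ 1# ⟨
        0# + 1#                 ≈⟨ +-congʳ 1+1≈0 ⟨
        (1# + 1#) + 1#          ≈⟨ +-cong (+-congˡ (trans (^ℕ-congˡ 2 z≈1) (1^ℕ≈1 2))) z≈1 ⟨
        (1# + z ^ℕ 2) + z       ≈⟨ D≈0 ⟩
        0#                      ∎)
        where
        z³≈1 : z ^ℕ 3 ≈ 1#
        z³≈1 = x+y≈0⇒y≈x (trans (sym ([1+z]*[1+z²+z]≈1+z³ z)) (trans (*-congˡ D≈0) (zeroʳ _)))
        z≈1 : z ≈ 1#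
        z≈1 = z³≈1⇒z≈1 N 3∤N zU z³≈1

      z²*D^[M∸1]≈1 : z ^ℕ 2 * D ^ℕ (M ∸ 1) ≈ 1#
      z²*D^[M∸1]≈1 = *-cancelʳ D≉0 (begin
        (z ^ℕ 2 * D ^ℕ (M ∸ 1)) * D     ≈⟨ *-assoc _ _ D ⟩
        z ^ℕ 2 * (D ^ℕ (M ∸ 1) * D)     ≈⟨ *-congˡ (*-congˡ (*-identityʳ D)) ⟨
        z ^ℕ 2 * (D ^ℕ (M ∸ 1) * D ^ℕ 1) ≈⟨ *-congˡ (^ℕ-homo-* D (M ∸ 1) 1) ⟨
        z ^ℕ 2 * D ^ℕ (M ∸ 1 +ℕ 1)      ≈⟨ *-congˡ (^ℕ-congʳ D (ℕ.m∸n+n≡m (ℕ.m^n>0 2 m))) ⟩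
        z ^ℕ 2 * D ^ℕ M                 ≈⟨ z²*D^M≈D ⟩
        D                               ≈⟨ *-identityˡ D ⟨
        1# * D                          ∎)

      z³*D^[M∸1]≈z : z ^ℕ 3 * ((1# + z ^ℕ 2) + z) ^ℕ (M ∸ 1) ≈ z
      z³*D^[M∸1]≈z = begin
        (z * z ^ℕ 2) * D ^ℕ (M ∸ 1)   ≈⟨ *-assoc z _ _ ⟩
        z * (z ^ℕ 2 * D ^ℕ (M ∸ 1))   ≈⟨ *-congˡ z²*D^[M∸1]≈1 ⟩
        z * 1#                        ≈⟨ *-identityʳ z ⟩
        z                             ∎

module _ {c ℓ q} (F : FiniteField c ℓ q) (m′ j′ : ℕ) where

  open FiniteField F
  open FF F
  open FieldProperties F
  open UnitCircle (suc m′)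
  open Modulus (suc m′)
  open Exponents m′ j′
  open import Relation.Binary.Reasoning.Setoid setoid

  g≈^b : 1# + 1# ≈ 0# → ¬ 3 ∣ℕ N → ∀ u {y} → InU (suc m′) y → g (suc m′) (suc j′) u y ≈ y ^ℕ b
  g≈^b 1+1≈0 3∤N u {y} yU = begin
    y ^ℤ d₁ (suc m′) (suc j′) u * ((1# + y ^ℤ (-ℤ (+ Q))) + y ^ℕ b) ^ℕ (M ∸ 1)
      ≈⟨ *-cong (^ℤ-congruent (d₁ (suc m′) (suc j′) u) (b *ℕ 3) yU (N∣d₁-3b u))
                (^ℕ-congˡ (M ∸ 1) (+-congʳ (+-congˡ (^ℤ-congruent (-ℤ (+ Q)) (b *ℕ 2) yU N∣-Q-2b)))) ⟩
    y ^ℕ (b *ℕ 3) * ((1# + y ^ℕ (b *ℕ 2)) + y ^ℕ b) ^ℕ (M ∸ 1)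
      ≈⟨ *-cong (^ℕ-assocʳ y b 3) (^ℕ-congˡ (M ∸ 1) (+-congʳ (+-congˡ (^ℕ-assocʳ y b 2)))) ⟨
    (y ^ℕ b) ^ℕ 3 * ((1# + (y ^ℕ b) ^ℕ 2) + y ^ℕ b) ^ℕ (M ∸ 1)
      ≈⟨ z³*D^[M∸1]≈z 1+1≈0 3∤N (InU-^ℕ b yU) ⟩
    y ^ℕ b ∎

theorem3p4 : ∀ {c ℓ : Level} (m j : ℕ) → 2 ≤ m → 1 ≤ j →
    (F : FiniteField c ℓ (2 ^ (2 *ℕ m))) → (u r₁ r₂ : ℤ) →
    gcd (d₁ m j u) (+ (2 ^ (2 *ℕ m) ∸ 1)) ≡ + 1 →
    gcd ((+ (2 ^ iExp m j)) -ℤ (+ (2 ^ j))) (+ (2 ^ m +ℕ 1)) ≡ + 1 →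
    (+ (2 ^ m +ℕ 1)) ∣ ((r₁ *ℤ (+ (2 ^ (m ∸ 1)))) -ℤ 1ℤ) →
    (+ (2 ^ m +ℕ 1)) ∣ ((r₂ *ℤ (+ (2 ^ (j ∸ 1)))) -ℤ 1ℤ) →
    ∀ x → FF.InU F m x →
    FF.InU F m (FF.g F m j u x) × FF.InU F m (FF.h F r₁ r₂ x)
    × FiniteField._≈_ F (FF.g F m j u (FF.h F r₁ r₂ x)) x
    × FiniteField._≈_ F (FF.h F r₁ r₂ (FF.g F m j u x)) x
theorem3p4 (suc m′) (suc j′) _ _ F u r₁ r₂ _ coprime r₁-inverse r₂-inverse x xU =
  gx∈U , hx∈U , g∘h≈id , h∘g≈id
  where
  open FiniteField F
  open FF F
  open FieldProperties F
  open UnitCircle (suc m′)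
  open Modulus (suc m′)
  open Exponents m′ j′
  open import Relation.Binary.Reasoning.Setoid setoid

  g≈ : ∀ {y} → InU (suc m′) y → g (suc m′) (suc j′) u y ≈ y ^ℕ b
  g≈ = g≈^b F m′ j′ (characteristic-two (m∣m*n (2 ^ (m′ +ℕ 1 *ℕ suc m′)))) (¬3∣N coprime) u

  e : ℕ
  e = rep (r₁ *ℤ r₂)

  N∣eb-1 : + N ∣ₛ + (e *ℕ b) -ℤ 1ℤ
  N∣eb-1 = rep-*-congruent {r₁ *ℤ r₂} {b} (N∣r₁r₂b-1 {r₁} {r₂} r₁-inverse r₂-inverse)

  gx∈U : InU (suc m′) (g (suc m′) (suc j′) u x)
  gx∈U = InU-resp-≈ (g≈ xU) (InU-^ℕ b xU)

  hx∈U : InU (suc m′) (h r₁ r₂ x)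
  hx∈U = InU-resp-≈ (^ℤ≈^ℕ-rep xU (r₁ *ℤ r₂)) (InU-^ℕ e xU)

  g∘h≈id : g (suc m′) (suc j′) u (h r₁ r₂ x) ≈ x
  g∘h≈id = begin
    g (suc m′) (suc j′) u (h r₁ r₂ x)  ≈⟨ g≈ hx∈U ⟩
    h r₁ r₂ x ^ℕ b                     ≈⟨ ^ℕ-congˡ b (^ℤ≈^ℕ-rep xU (r₁ *ℤ r₂)) ⟩
    (x ^ℕ e) ^ℕ b                      ≈⟨ ^ℕ-inverse e b xU N∣eb-1 ⟩
    x                                  ∎

  h∘g≈id : h r₁ r₂ (g (suc m′) (suc j′) u x) ≈ x
  h∘g≈id = begin
    h r₁ r₂ (g (suc m′) (suc j′) u x)  ≈⟨ ^ℤ≈^ℕ-rep gx∈U (r₁ *ℤ r₂) ⟩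
    g (suc m′) (suc j′) u x ^ℕ e       ≈⟨ ^ℕ-congˡ e (g≈ xU) ⟩
    (x ^ℕ b) ^ℕ e                      ≈⟨ ^ℕ-inverse b e xU (≡.subst (λ n → + N ∣ₛ + n -ℤ 1ℤ) (ℕ.*-comm e b) N∣eb-1) ⟩
    x                                  ∎
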